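{- For any $m,n\geq 2$, $\mathrm{MEG}(G(m,n))=2(m+n-2)$, where $G(m,n)=P_m\,\square\,P_n$ is the $m\times n$ grid graph.
   Context: $G(m,n)$ has vertex set $\{(i,j): 1\le i\le m,\ 1\le j\le n\}$, with $(i,j)$ and $(i',j')$ adjacent iff $|i-i'|+|j-j'|=1$. Two vertices $x,y$ of a graph $G$ monitor an edge $e$ if $e$ belongs to all shortest paths between $x$ and $y$. A set $S\subseteq V(G)$ is a monitoring edge-geodetic set (MEG-set) if for every edge $e$ of $G$ there is a pair $x,y\in S$ that monitors $e$. $\mathrm{MEG}(G)$ denotes the minimum size of an MEG-set of $G$. -}

module Defs where

open import Level using (Level; _⊔_) renaming (suc to lsuc)
open import Data.Nat using (ℕ; zero; suc; _≤_; ∣_-_∣; _+_)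
open import Data.Fin using (Fin; toℕ)
open import Data.Product using (_×_; _,_; ∃; ∃-syntax; Σ)
open import Data.Sum using (_⊎_)
open import Data.List using (List; length)
open import Data.List.Membership.Propositional using (_∈_)
open import Data.List.Relation.Unary.Unique.Propositional using (Unique)
open import Relation.Binary.PropositionalEquality using (_≡_)

record Graph : Set₁ where
  field
    V   : Set
    Adj : V → V → Set

module _ (G : Graph) where
  open Graph G

  data Walk : V → V → Set where
    nil  : (x : V) → Walk x x
    cons : {x y z : V} → Adj x y → Walk y z → Walk x z

  len : {x y : V} → Walk x y → ℕ
  len (nil _)    = zero
  len (cons _ w) = suc (len w)

  IsShortest : {x y : V} → Walk x y → Set
  IsShortest {x} {y} p = (q : Walk x y) → len p ≤ len q

  data EdgeIn (u v : V) : {x y : V} → Walk x y → Set where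
    here  : {x y z : V} (a : Adj x y) (w : Walk y z) →
            ((x ≡ u) × (y ≡ v)) ⊎ ((x ≡ v) × (y ≡ u)) → EdgeIn u v (cons a w)
    there : {x y z : V} (a : Adj x y) (w : Walk y z) →
            EdgeIn u v w → EdgeIn u v (cons a w)

  Monitors : V → V → V → V → Set
  Monitors x y u v = (p : Walk x y) → IsShortest p → EdgeIn u v p

  IsMEGSet : List V → Set
  IsMEGSet S = (u v : V) → Adj u v →
               ∃[ x ] ∃[ y ] (x ∈ S × y ∈ S × Monitors x y u v)

  IsMEG : ℕ → Set
  IsMEG k = (∃[ S ] (Unique S × IsMEGSet S × length S ≡ k))
          × ((S : List V) → Unique S → IsMEGSet S → k ≤ length S)

Grid : ℕ → ℕ → Graph
Grid m n = record
  { V   = Fin m × Fin n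
  ; Adj = λ { (i , j) (i' , j') → ∣ toℕ i - toℕ i' ∣ + ∣ toℕ j - toℕ j' ∣ ≡ 1 }
  }

{-# OPTIONS --safe #-}
module Submission where

-- Put coordinates (row, column) on the grid, so that adjacency is distance 1 in the
-- ℓ¹ metric and walk lengths are bounded below by that distance.
-- Upper bound: the 2(m+n-2) boundary vertices form an MEG-set.  An edge inside row p lies
-- on every shortest path between the two ends of row p: such a path has length n-1, so
-- each of its steps moves one column to the right within row p.
-- Lower bound: every MEG-set contains every boundary vertex.  If x and y monitor the
-- vertical edge from a top vertex u to the vertex below it, the edge lies on both
-- L-shaped shortest x–y paths (row first, and column first); this puts x and y in the
-- column of u with u's row between theirs, so one of them is u.
-- Transposing rows and columns, and using the last row as well as the first, covers the
-- other edges and the other sides.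

open import Function using (_∘_; id)
open import Data.Nat using (ℕ; zero; suc; pred; _≤_; _<_; _+_; _*_; _∸_; _⊓_; _⊔_; ∣_-_∣; z≤n; s≤s; z<s; s<s; _≟_)
open import Data.Nat.Properties
open import Data.Nat.Tactic.RingSolver using (solve-∀)
open import Algebra.Properties.CommutativeSemigroup +-commutativeSemigroup using (interchange)
open import Data.Product using (_×_; _,_; proj₁; proj₂)
open import Data.Sum using (_⊎_; inj₁; inj₂; [_,_]′)
open import Relation.Nullary using (yes; no; contradiction)
open import Relation.Binary.PropositionalEquality
open import Data.Fin using (Fin; zero; suc; toℕ; fromℕ; inject₁; lower₁)
open import Data.Fin.Properties using (toℕ-injective; toℕ≤pred[n]; toℕ-fromℕ; inject₁-injective; inject₁-lower₁; fromℕ≢inject₁)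
import Data.Fin.Properties as Fin
open import Data.List using (List; []; _∷_; length; map; _++_; allFin)
open import Data.List.Properties using (length-++; length-map; length-tabulate; length-removeAt′)
open import Data.List.Relation.Unary.Any using (here; there; index; _─_)
import Data.List.Relation.Unary.All as All
open import Data.List.Relation.Unary.AllPairs using (_∷_)
open import Data.List.Relation.Unary.Unique.Propositional using (Unique)
import Data.List.Relation.Unary.Unique.Propositional.Properties as Unique
open import Data.List.Relation.Binary.Disjoint.Propositional using (Disjoint)
open import Data.List.Membership.Propositional using (_∈_)
open import Data.List.Membership.Propositional.Properties using (∈-map⁺; ∈-map⁻; ∈-++⁺ˡ; ∈-++⁺ʳ; ∈-++⁻; ∈-allFin)
open import Defs

∣n-1+n∣≡1 : ∀ n → ∣ n - suc n ∣ ≡ 1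
∣n-1+n∣≡1 zero    = refl
∣n-1+n∣≡1 (suc n) = ∣n-1+n∣≡1 n

∣1+n-n∣≡1 : ∀ n → ∣ suc n - n ∣ ≡ 1
∣1+n-n∣≡1 n = trans (∣-∣-comm (suc n) n) (∣n-1+n∣≡1 n)

∣m-n∣≡1⇒ : ∀ {m n} → ∣ m - n ∣ ≡ 1 → n ≡ suc m ⊎ m ≡ suc n
∣m-n∣≡1⇒ {zero}     {suc zero} _ = inj₁ refl
∣m-n∣≡1⇒ {suc zero} {zero}     _ = inj₂ refl
∣m-n∣≡1⇒ {suc m}    {suc n}    e with ∣m-n∣≡1⇒ {m} {n} e
... | inj₁ n≡1+m = inj₁ (cong suc n≡1+m)
... | inj₂ m≡1+n = inj₂ (cong suc m≡1+n)

∣n-pred[n]∣≡1 : ∀ {n} → 1 ≤ n → ∣ n - pred n ∣ ≡ 1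
∣n-pred[n]∣≡1 {suc n} _ = ∣1+n-n∣≡1 n

∣m-n∣≡1⇒m≢n : ∀ {m n} → ∣ m - n ∣ ≡ 1 → m ≢ n
∣m-n∣≡1⇒m≢n {m} ∣m-n∣≡1 refl = 0≢1+n (trans (sym (∣n-n∣≡0 m)) ∣m-n∣≡1)

m+n≡1⇒ : ∀ m {n} → m + n ≡ 1 → m ≡ 0 ⊎ n ≡ 0
m+n≡1⇒ zero          _ = inj₁ refl
m+n≡1⇒ (suc zero)    e = inj₂ (suc-injective e)
m+n≡1⇒ (suc (suc m)) ()

unit-step : ∀ a b {c d} → ∣ a - b ∣ + ∣ c - d ∣ ≡ 1 → c < d → a ≡ b × d ≡ suc c
unit-step a b e c<d with ∣ a - b ∣ in eq
... | suc k = contradiction (∣m-n∣≡0⇒m≡n (m+n≡0⇒n≡0 k (suc-injective e))) (<⇒≢ c<d)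
... | zero with ∣m-n∣≡1⇒ e
...   | inj₁ d≡1+c = ∣m-n∣≡0⇒m≡n eq , d≡1+c
...   | inj₂ c≡1+d = contradiction c<d (<-asym (≤-reflexive (sym c≡1+d)))

Between : ℕ → ℕ → ℕ → Set
Between a b c = a ⊓ b ≤ c × c ≤ a ⊔ b

Between-sym : ∀ {a b c} → Between a b c → Between b a c
Between-sym {a} {b} (lo , hi) = subst (_≤ _) (⊓-comm a b) lo , subst (_ ≤_) (⊔-comm a b) hi

between-+ : ∀ a {i k} → i ≤ k → Between a (k + a) (i + a)
between-+ a {i} {k} i≤k = ≤-trans (m⊓n≤m a (k + a)) (m≤n+m a i) , ≤-trans (+-monoˡ-≤ a i≤k) (m≤n⊔m a (k + a))

Extreme : ℕ → ℕ → Set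
Extreme R c = ∀ {a b} → a ≤ R → b ≤ R → Between a b c → a ≡ c ⊎ b ≡ c

0-extreme : ∀ {R} → Extreme R 0
0-extreme {a = a} {b} _ _ (lo , _) with ⊓-sel a b
... | inj₁ a⊓b≡a = inj₁ (n≤0⇒n≡0 (subst (_≤ 0) a⊓b≡a lo))
... | inj₂ a⊓b≡b = inj₂ (n≤0⇒n≡0 (subst (_≤ 0) a⊓b≡b lo))

max-extreme : ∀ {R} → Extreme R R
max-extreme {a = a} {b} a≤R b≤R (_ , hi) with ⊔-sel a b
... | inj₁ a⊔b≡a = inj₁ (≤-antisym a≤R (subst (_ ≤_) a⊔b≡a hi))
... | inj₂ a⊔b≡b = inj₂ (≤-antisym b≤R (subst (_ ≤_) a⊔b≡b hi))

offset≤ : ∀ {a i k m} → i ≤ k → k + a ≤ m → i + a ≤ m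
offset≤ {a} i≤k = ≤-trans (+-monoˡ-≤ a i≤k)

∣m-n+m∣≡n : ∀ m n → ∣ m - n + m ∣ ≡ n
∣m-n+m∣≡n m n = trans (cong (∣ m -_∣) (+-comm n m)) (∣m-m+n∣≡n m n)

-- Exposes the difference of the indices as an offset, so that a walk along a row can be
-- indexed by k + a and needs no transport along m ∸ n + n ≡ m.
data Span : ℕ → ℕ → Set where
  ascending  : ∀ a k → Span a (k + a)
  descending : ∀ b k → Span (k + b) b

span : ∀ a b → Span a b
span a b with ≤-total a b
... | inj₁ a≤b = subst (Span a) (m∸n+n≡m a≤b) (ascending a (b ∸ a))
... | inj₂ b≤a = subst (λ c → Span c b) (m∸n+n≡m b≤a) (descending b (a ∸ b))

module _ {A : Set} where

  ∈-─ : ∀ {x y : A} {ys} (x∈ys : x ∈ ys) → y ∈ ys → y ≢ x → y ∈ (ys ─ x∈ys)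
  ∈-─ (here refl) (here refl) y≢x = contradiction refl y≢x
  ∈-─ (here _)    (there y∈)  _   = y∈
  ∈-─ (there _)   (here refl) _   = here refl
  ∈-─ (there x∈)  (there y∈)  y≢x = there (∈-─ x∈ y∈ y≢x)

  Unique-⊆⇒length≤ : ∀ {xs ys : List A} → Unique xs → (∀ {z} → z ∈ xs → z ∈ ys) → length xs ≤ length ys
  Unique-⊆⇒length≤ {[]}          _            _   = z≤n
  Unique-⊆⇒length≤ {x ∷ xs} {ys} (x∉xs ∷ xs!) ⊆ys = begin
    suc (length xs)          ≤⟨ s≤s (Unique-⊆⇒length≤ xs! (λ z∈xs → ∈-─ x∈ys (⊆ys (there z∈xs)) (x≢z z∈xs ∘ sym))) ⟩
    suc (length (ys ─ x∈ys)) ≡⟨ length-removeAt′ ys (index x∈ys) ⟨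
    length ys                ∎
    where
    open ≤-Reasoning
    x∈ys : x ∈ ys
    x∈ys = ⊆ys (here refl)
    x≢z : ∀ {z} → z ∈ xs → x ≢ z
    x≢z = All.lookup x∉xs

module _ {G : Graph} where
  open Graph G

  infixr 5 _++ʷ_

  _++ʷ_ : ∀ {x y z} → Walk G x y → Walk G y z → Walk G x z
  nil _    ++ʷ q = q
  cons a p ++ʷ q = cons a (p ++ʷ q)

  length-++ʷ : ∀ {x y z} (p : Walk G x y) (q : Walk G y z) → len G (p ++ʷ q) ≡ len G p + len G q
  length-++ʷ (nil _)    q = refl
  length-++ʷ (cons a p) q = cong suc (length-++ʷ p q)

  EdgeIn-++ʷ⁻ : ∀ {u v x y z} (p : Walk G x y) (q : Walk G y z) →
                EdgeIn G u v (p ++ʷ q) → EdgeIn G u v p ⊎ EdgeIn G u v q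
  EdgeIn-++ʷ⁻ (nil _)    q e              = inj₂ e
  EdgeIn-++ʷ⁻ (cons a p) q (here _ _ uv)  = inj₁ (here a p uv)
  EdgeIn-++ʷ⁻ (cons a p) q (there _ _ e) with EdgeIn-++ʷ⁻ p q e
  ... | inj₁ e′ = inj₁ (there a p e′)
  ... | inj₂ e′ = inj₂ e′

  EdgeIn-sym : ∀ {u v x y} {w : Walk G x y} → EdgeIn G u v w → EdgeIn G v u w
  EdgeIn-sym (here a w (inj₁ uv)) = here a w (inj₂ uv)
  EdgeIn-sym (here a w (inj₂ vu)) = here a w (inj₁ vu)
  EdgeIn-sym (there a w e)        = there a w (EdgeIn-sym e)

  data AllVertices (P : V → Set) : ∀ {x y} → Walk G x y → Set where
    nil  : ∀ {x} → P x → AllVertices P (nil x)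
    cons : ∀ {x y z} {a : Adj x y} {w : Walk G y z} → P x → AllVertices P w → AllVertices P (cons a w)

  AllVertices-source : ∀ {P : V → Set} {x y} {w : Walk G x y} → AllVertices P w → P x
  AllVertices-source (nil Px)    = Px
  AllVertices-source (cons Px _) = Px

  EdgeIn⇒AllVertices : ∀ {P : V → Set} {u v x y} {w : Walk G x y} →
                       AllVertices P w → EdgeIn G u v w → P u × P v
  EdgeIn⇒AllVertices (cons Px Pw) (here _ _ (inj₁ (refl , refl))) = Px , AllVertices-source Pw
  EdgeIn⇒AllVertices (cons Px Pw) (here _ _ (inj₂ (refl , refl))) = AllVertices-source Pw , Px
  EdgeIn⇒AllVertices (cons _ Pw)  (there _ _ e)                   = EdgeIn⇒AllVertices Pw e

  ascent : (f : ℕ → V) (k : ℕ) → (∀ i → i < k → Adj (f i) (f (suc i))) → Walk G (f 0) (f k)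
  ascent f zero    _   = nil (f 0)
  ascent f (suc k) adj = cons (adj 0 z<s) (ascent (f ∘ suc) k (λ i i<k → adj (suc i) (s<s i<k)))

  descent : (f : ℕ → V) (k : ℕ) → (∀ i → i < k → Adj (f (suc i)) (f i)) → Walk G (f k) (f 0)
  descent f zero    _   = nil (f 0)
  descent f (suc k) adj = cons (adj k ≤-refl) (descent f k (λ i i<k → adj i (m<n⇒m<1+n i<k)))

  length-ascent : ∀ f k adj → len G (ascent f k adj) ≡ k
  length-ascent f zero    _   = refl
  length-ascent f (suc k) adj = cong suc (length-ascent (f ∘ suc) k _)

  length-descent : ∀ f k adj → len G (descent f k adj) ≡ k
  length-descent f zero    _   = refl
  length-descent f (suc k) adj = cong suc (length-descent f k _)

  ascent-vertices : ∀ {P : V → Set} f k adj → (∀ i → i ≤ k → P (f i)) → AllVertices P (ascent f k adj)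
  ascent-vertices f zero    _   Pf = nil (Pf 0 z≤n)
  ascent-vertices f (suc k) adj Pf = cons (Pf 0 z≤n) (ascent-vertices (f ∘ suc) k _ (λ i i≤k → Pf (suc i) (s≤s i≤k)))

  descent-vertices : ∀ {P : V → Set} f k adj → (∀ i → i ≤ k → P (f i)) → AllVertices P (descent f k adj)
  descent-vertices f zero    _   Pf = nil (Pf 0 z≤n)
  descent-vertices f (suc k) adj Pf = cons (Pf (suc k) ≤-refl) (descent-vertices f k _ (λ i i≤k → Pf i (m≤n⇒m≤1+n i≤k)))

record GridChart (G : Graph) : Set where
  open Graph G
  field
    row col          : V → ℕ
    maxRow maxCol    : ℕ
    row≤maxRow       : ∀ x → row x ≤ maxRow
    col≤maxCol       : ∀ x → col x ≤ maxCol
    vertex           : ℕ → ℕ → V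
    row-vertex       : ∀ {p q} → p ≤ maxRow → row (vertex p q) ≡ p
    col-vertex       : ∀ {p q} → q ≤ maxCol → col (vertex p q) ≡ q
    coords-injective : ∀ {x y} → row x ≡ row y → col x ≡ col y → x ≡ y
    Adj⇒distance≡1   : ∀ {x y} → Adj x y → ∣ row x - row y ∣ + ∣ col x - col y ∣ ≡ 1
    distance≡1⇒Adj   : ∀ {x y} → ∣ row x - row y ∣ + ∣ col x - col y ∣ ≡ 1 → Adj x y

transpose : ∀ {G} → GridChart G → GridChart G
transpose Γ = record
  { row              = col
  ; col              = row
  ; maxRow           = maxCol
  ; maxCol           = maxRow
  ; row≤maxRow       = col≤maxCol
  ; col≤maxCol       = row≤maxRow
  ; vertex           = λ p q → vertex q p
  ; row-vertex       = col-vertex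
  ; col-vertex       = row-vertex
  ; coords-injective = λ cx≡cy rx≡ry → coords-injective rx≡ry cx≡cy
  ; Adj⇒distance≡1   = λ {x} {y} a → trans (+-comm ∣ col x - col y ∣ _) (Adj⇒distance≡1 a)
  ; distance≡1⇒Adj   = λ {x} {y} d → distance≡1⇒Adj (trans (+-comm ∣ row x - row y ∣ _) d)
  }
  where open GridChart Γ

module Geodesics {G : Graph} (Γ : GridChart G) where
  open Graph G
  open GridChart Γ

  distance : V → V → ℕ
  distance x y = ∣ row x - row y ∣ + ∣ col x - col y ∣

  distance-triangle : ∀ x y z → distance x z ≤ distance x y + distance y z
  distance-triangle x y z = begin
    distance x z
      ≤⟨ +-mono-≤ (∣-∣-triangle (row x) (row y) (row z)) (∣-∣-triangle (col x) (col y) (col z)) ⟩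
    (∣ row x - row y ∣ + ∣ row y - row z ∣) + (∣ col x - col y ∣ + ∣ col y - col z ∣)
      ≡⟨ interchange ∣ row x - row y ∣ _ _ _ ⟩
    distance x y + distance y z ∎
    where open ≤-Reasoning

  distance≤length : ∀ {x y} (w : Walk G x y) → distance x y ≤ len G w
  distance≤length {x} (nil _) = ≤-reflexive (cong₂ _+_ (∣n-n∣≡0 (row x)) (∣n-n∣≡0 (col x)))
  distance≤length {x} {z} (cons {y = y} a w) = begin
    distance x z                ≤⟨ distance-triangle x y z ⟩
    distance x y + distance y z ≡⟨ cong (_+ distance y z) (Adj⇒distance≡1 a) ⟩
    suc (distance y z)          ≤⟨ s≤s (distance≤length w) ⟩
    suc (len G w)               ∎
    where open ≤-Reasoning

  length≡distance⇒shortest : ∀ {x y} (w : Walk G x y) → len G w ≡ distance x y → IsShortest G w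
  length≡distance⇒shortest w len≡d q = ≤-trans (≤-reflexive len≡d) (distance≤length q)

  distance-vertex : ∀ {a b c d} → a ≤ maxRow → b ≤ maxCol → c ≤ maxRow → d ≤ maxCol →
                    distance (vertex a b) (vertex c d) ≡ ∣ a - c ∣ + ∣ b - d ∣
  distance-vertex a≤ b≤ c≤ d≤ =
    cong₂ _+_ (cong₂ ∣_-_∣ (row-vertex a≤) (row-vertex c≤)) (cong₂ ∣_-_∣ (col-vertex b≤) (col-vertex d≤))

  vertex-η : ∀ x → vertex (row x) (col x) ≡ x
  vertex-η x = coords-injective (row-vertex (row≤maxRow x)) (col-vertex (col≤maxCol x))

  vertical-neighbour : ∀ {x r} → r ≤ maxRow → ∣ row x - r ∣ ≡ 1 → Adj x (vertex r (col x))
  vertical-neighbour {x} {r} r≤ ∣rx-r∣≡1 = distance≡1⇒Adj (begin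
    ∣ row x - row (vertex r (col x)) ∣ + ∣ col x - col (vertex r (col x)) ∣
      ≡⟨ cong₂ _+_ (cong (∣ row x -_∣) (row-vertex r≤)) (cong (∣ col x -_∣) (col-vertex (col≤maxCol x))) ⟩
    ∣ row x - r ∣ + ∣ col x - col x ∣ ≡⟨ cong₂ _+_ ∣rx-r∣≡1 (∣n-n∣≡0 (col x)) ⟩
    1                                 ∎)
    where open ≡-Reasoning

  sameRow-Adj⇒ : ∀ {u v} → Adj u v → row u ≡ row v → ∣ col u - col v ∣ ≡ 1
  sameRow-Adj⇒ {u} {v} a ru≡rv =
    subst (λ r → r + ∣ col u - col v ∣ ≡ 1) (m≡n⇒∣m-n∣≡0 ru≡rv) (Adj⇒distance≡1 a)

  module _ {p : ℕ} (p≤ : p ≤ maxRow) where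

    rowNeighbours : ∀ {j k} → j ≤ maxCol → k ≤ maxCol → ∣ j - k ∣ ≡ 1 → Adj (vertex p j) (vertex p k)
    rowNeighbours {j} {k} j≤ k≤ d =
      distance≡1⇒Adj (trans (distance-vertex p≤ j≤ p≤ k≤) (trans (cong (_+ ∣ j - k ∣) (∣n-n∣≡0 p)) d))

    alongRow : ∀ {a b} → Span a b → a ≤ maxCol → b ≤ maxCol → Walk G (vertex p a) (vertex p b)
    alongRow (ascending a k) _ b≤ =
      ascent (λ i → vertex p (i + a)) k
        (λ i i<k → rowNeighbours (offset≤ (<⇒≤ i<k) b≤) (offset≤ i<k b≤) (∣n-1+n∣≡1 (i + a)))
    alongRow (descending b k) a≤ _ =
      descent (λ i → vertex p (i + b)) k
        (λ i i<k → rowNeighbours (offset≤ i<k a≤) (offset≤ (<⇒≤ i<k) a≤) (∣1+n-n∣≡1 (i + b)))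

    length-alongRow : ∀ {a b} (s : Span a b) a≤ b≤ → len G (alongRow s a≤ b≤) ≡ ∣ a - b ∣
    length-alongRow (ascending a k)  _ _ = trans (length-ascent _ k _) (sym (∣m-n+m∣≡n a k))
    length-alongRow (descending b k) _ _ =
      trans (length-descent _ k _) (sym (trans (∣-∣-comm (k + b) b) (∣m-n+m∣≡n b k)))

    alongRow-vertices : ∀ {a b} (s : Span a b) a≤ b≤ →
                        AllVertices (λ z → row z ≡ p × Between a b (col z)) (alongRow s a≤ b≤)
    alongRow-vertices (ascending a k) _ b≤ = ascent-vertices _ k _ λ i i≤k →
      row-vertex p≤ , subst (Between a (k + a)) (sym (col-vertex (offset≤ i≤k b≤))) (between-+ a i≤k)
    alongRow-vertices (descending b k) a≤ _ = descent-vertices _ k _ λ i i≤k →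
      row-vertex p≤ , subst (Between (k + b) b) (sym (col-vertex (offset≤ i≤k a≤))) (Between-sym (between-+ b i≤k))

  tight-first-step : ∀ {s y t} → Adj s y → (w : Walk G y t) → suc (len G w) + col s ≤ col t →
                     row s ≡ row y × col y ≡ suc (col s)
  tight-first-step {s} {y} {t} a w tight = unit-step (row s) (row y) (Adj⇒distance≡1 a) cs<cy
    where
    open ≤-Reasoning
    cs<cy : col s < col y
    cs<cy = +-cancelˡ-≤ (len G w) _ _ (begin
      len G w + suc (col s)     ≡⟨ +-suc (len G w) (col s) ⟩
      suc (len G w) + col s     ≤⟨ tight ⟩
      col t                     ≤⟨ m≤n+∣n-m∣ (col t) (col y) ⟩
      col y + ∣ col y - col t ∣ ≤⟨ +-monoʳ-≤ (col y) (≤-trans (m≤n+m _ _) (distance≤length w)) ⟩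
      col y + len G w           ≡⟨ +-comm (col y) (len G w) ⟩
      len G w + col y           ∎)

  -- A walk no longer than the column increase between its ends steps one column to the
  -- right each time, so it crosses every edge of its row between its ends.
  tight-walk-crosses : ∀ {s t u v} (w : Walk G s t) → len G w + col s ≤ col t →
                       row u ≡ row s → row v ≡ row s → col s ≤ col u → col v ≡ suc (col u) → col v ≤ col t →
                       EdgeIn G u v w
  tight-walk-crosses {s} (nil _) _ _ _ s≤u v≡1+u v≤s =
    contradiction (≤-trans (s≤s s≤u) (subst (_≤ col s) v≡1+u v≤s)) (n≮n (col s))
  tight-walk-crosses {s} {t} {u} {v} (cons {y = y} a w) tight ru rv s≤u v≡1+u v≤t
    with tight-first-step a w tight | col s ≟ col u
  ... | rs≡ry , cy≡1+cs | yes s≡u =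
    here a w (inj₁ (coords-injective (sym ru) s≡u ,
                    coords-injective (trans (sym rs≡ry) (sym rv)) (trans cy≡1+cs (trans (cong suc s≡u) (sym v≡1+u)))))
  ... | rs≡ry , cy≡1+cs | no s≢u =
    there a w (tight-walk-crosses w tight′ (trans ru rs≡ry) (trans rv rs≡ry) y≤u v≡1+u v≤t)
    where
    tight′ : len G w + col y ≤ col t
    tight′ = subst (λ c → len G w + c ≤ col t) (sym cy≡1+cs) (≤-trans (≤-reflexive (+-suc _ _)) tight)
    y≤u : col y ≤ col u
    y≤u = subst (_≤ col u) (sym cy≡1+cs) (≤∧≢⇒< s≤u s≢u)

  row-edge-monitored : ∀ {u v} → Adj u v → row u ≡ row v →
                       Monitors G (vertex (row u) 0) (vertex (row u) maxCol) u v
  row-edge-monitored {u} {v} a ru≡rv w shortest =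
    [ crosses refl (sym ru≡rv) , (λ u≡1+v → EdgeIn-sym (crosses (sym ru≡rv) refl u≡1+v)) ]′
      (∣m-n∣≡1⇒ (sameRow-Adj⇒ a ru≡rv))
    where
    open ≤-Reasoning
    ru≤ : row u ≤ maxRow
    ru≤ = row≤maxRow u
    straight : Walk G (vertex (row u) 0) (vertex (row u) maxCol)
    straight = alongRow ru≤ (span 0 maxCol) z≤n ≤-refl
    tight : len G w + col (vertex (row u) 0) ≤ col (vertex (row u) maxCol)
    tight = begin
      len G w + col (vertex (row u) 0) ≡⟨ cong (len G w +_) (col-vertex z≤n) ⟩
      len G w + 0                      ≡⟨ +-identityʳ (len G w) ⟩
      len G w                          ≤⟨ shortest straight ⟩
      len G straight                   ≡⟨ length-alongRow ru≤ (span 0 maxCol) z≤n ≤-refl ⟩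
      maxCol                           ≡⟨ col-vertex ≤-refl ⟨
      col (vertex (row u) maxCol)      ∎
    crosses : ∀ {u′ v′} → row u′ ≡ row u → row v′ ≡ row u → col v′ ≡ suc (col u′) → EdgeIn G u′ v′ w
    crosses {u′} {v′} ru′ rv′ v′≡1+u′ =
      tight-walk-crosses w tight (trans ru′ (sym (row-vertex ru≤))) (trans rv′ (sym (row-vertex ru≤)))
        (subst (_≤ col u′) (sym (col-vertex z≤n)) z≤n) v′≡1+u′
        (subst (col v′ ≤_) (sym (col-vertex ≤-refl)) (col≤maxCol v′))

module LPaths {G : Graph} (Γ : GridChart G) where
  open Graph G
  open GridChart Γ
  open Geodesics Γ
  private module ᵀ = Geodesics (transpose Γ)

  rowPart : ∀ x y → Walk G (vertex (row x) (col x)) (vertex (row x) (col y))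
  rowPart x y = alongRow (row≤maxRow x) (span (col x) (col y)) (col≤maxCol x) (col≤maxCol y)

  colPart : ∀ x y → Walk G (vertex (row x) (col y)) (vertex (row y) (col y))
  colPart x y = ᵀ.alongRow (col≤maxCol y) (span (row x) (row y)) (row≤maxRow x) (row≤maxRow y)

  rowThenColumn : ∀ x y → Walk G (vertex (row x) (col x)) (vertex (row y) (col y))
  rowThenColumn x y = rowPart x y ++ʷ colPart x y

  rowPart-vertices : ∀ x y → AllVertices (λ z → row z ≡ row x × Between (col x) (col y) (col z)) (rowPart x y)
  rowPart-vertices x y = alongRow-vertices (row≤maxRow x) (span (col x) (col y)) (col≤maxCol x) (col≤maxCol y)

  colPart-vertices : ∀ x y → AllVertices (λ z → col z ≡ col y × Between (row x) (row y) (row z)) (colPart x y)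
  colPart-vertices x y = ᵀ.alongRow-vertices (col≤maxCol y) (span (row x) (row y)) (row≤maxRow x) (row≤maxRow y)

  rowThenColumn-shortest : ∀ x y → IsShortest G (rowThenColumn x y)
  rowThenColumn-shortest x y = length≡distance⇒shortest (rowThenColumn x y) (begin
    len G (rowThenColumn x y)                      ≡⟨ length-++ʷ (rowPart x y) (colPart x y) ⟩
    len G (rowPart x y) + len G (colPart x y)      ≡⟨ cong₂ _+_ (length-alongRow rx≤ (span (col x) (col y)) cx≤ cy≤)
                                                                (ᵀ.length-alongRow cy≤ (span (row x) (row y)) rx≤ ry≤) ⟩
    ∣ col x - col y ∣ + ∣ row x - row y ∣          ≡⟨ +-comm ∣ col x - col y ∣ _ ⟩
    ∣ row x - row y ∣ + ∣ col x - col y ∣          ≡⟨ distance-vertex rx≤ cx≤ ry≤ cy≤ ⟨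
    distance (vertex (row x) (col x)) (vertex (row y) (col y)) ∎)
    where
    open ≡-Reasoning
    rx≤ : row x ≤ maxRow
    rx≤ = row≤maxRow x
    cx≤ : col x ≤ maxCol
    cx≤ = col≤maxCol x
    ry≤ : row y ≤ maxRow
    ry≤ = row≤maxRow y
    cy≤ : col y ≤ maxCol
    cy≤ = col≤maxCol y

module Pinning {G : Graph} (Γ : GridChart G) where
  open Graph G
  open GridChart Γ
  open Geodesics Γ using (vertex-η; vertical-neighbour)
  open LPaths Γ
  private module ᵀ = LPaths (transpose Γ)

  -- The edge lies on both L-shaped shortest x–y paths, and on neither horizontal leg.
  monitors-of-vertical-edge : ∀ {x y u v} → Monitors G x y u v → row u ≢ row v →
                              col x ≡ col u × col y ≡ col u × Between (row x) (row y) (row u)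
  monitors-of-vertical-edge {x} {y} {u} {v} mon ru≢rv = proj₁ colFirst , rowFirst , proj₂ colFirst
    where
    mon′ : Monitors G (vertex (row x) (col x)) (vertex (row y) (col y)) u v
    mon′ = subst₂ (λ x y → Monitors G x y u v) (sym (vertex-η x)) (sym (vertex-η y)) mon

    rowFirst : col y ≡ col u
    rowFirst with EdgeIn-++ʷ⁻ (rowPart x y) (colPart x y) (mon′ (rowThenColumn x y) (rowThenColumn-shortest x y))
    ... | inj₁ e with EdgeIn⇒AllVertices (rowPart-vertices x y) e
    ...   | (ru≡rx , _) , (rv≡rx , _) = contradiction (trans ru≡rx (sym rv≡rx)) ru≢rv
    rowFirst | inj₂ e = sym (proj₁ (proj₁ (EdgeIn⇒AllVertices (colPart-vertices x y) e)))

    colFirst : col x ≡ col u × Between (row x) (row y) (row u)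
    colFirst with EdgeIn-++ʷ⁻ (ᵀ.rowPart x y) (ᵀ.colPart x y) (mon′ (ᵀ.rowThenColumn x y) (ᵀ.rowThenColumn-shortest x y))
    ... | inj₁ e with EdgeIn⇒AllVertices (ᵀ.rowPart-vertices x y) e
    ...   | (cu≡cx , between) , _ = sym cu≡cx , between
    colFirst | inj₂ e with EdgeIn⇒AllVertices (ᵀ.colPart-vertices x y) e
    ...   | (ru≡ry , _) , (rv≡ry , _) = contradiction (trans ru≡ry (sym rv≡ry)) ru≢rv

  extreme-row⊆MEG-set : ∀ {S x r} → IsMEGSet G S → Extreme maxRow (row x) →
                        r ≤ maxRow → ∣ row x - r ∣ ≡ 1 → x ∈ S
  extreme-row⊆MEG-set {S} {x} {r} meg extreme r≤ ∣rx-r∣≡1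
    with meg x (vertex r (col x)) (vertical-neighbour r≤ ∣rx-r∣≡1)
  ... | y₁ , y₂ , y₁∈S , y₂∈S , mon
    with monitors-of-vertical-edge mon (∣m-n∣≡1⇒m≢n (trans (cong (∣ row x -_∣) (row-vertex r≤)) ∣rx-r∣≡1))
  ... | c₁ , c₂ , between with extreme (row≤maxRow y₁) (row≤maxRow y₂) between
  ...   | inj₁ r₁ = subst (_∈ S) (coords-injective r₁ c₁) y₁∈S
  ...   | inj₂ r₂ = subst (_∈ S) (coords-injective r₂ c₂) y₂∈S

module Boundary {G : Graph} (Γ : GridChart G) where
  open Graph G
  open GridChart Γ
  private
    module Rows            = Pinning Γ
    module Columns         = Pinning (transpose Γ)
    module ColumnGeodesics = Geodesics (transpose Γ)
  open Geodesics Γ using (row-edge-monitored)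

  OnBoundary : V → Set
  OnBoundary x = row x ≡ 0 ⊎ row x ≡ maxRow ⊎ col x ≡ 0 ⊎ col x ≡ maxCol

  boundary⊆MEG-set : ∀ {S x} → 1 ≤ maxRow → 1 ≤ maxCol → IsMEGSet G S → OnBoundary x → x ∈ S
  boundary⊆MEG-set 1≤R _ meg (inj₁ rx≡0) =
    Rows.extreme-row⊆MEG-set meg (subst (Extreme maxRow) (sym rx≡0) 0-extreme) 1≤R (cong (∣_- 1 ∣) rx≡0)
  boundary⊆MEG-set 1≤R _ meg (inj₂ (inj₁ rx≡R)) =
    Rows.extreme-row⊆MEG-set meg (subst (Extreme maxRow) (sym rx≡R) max-extreme) pred[n]≤n
      (trans (cong (∣_- pred maxRow ∣) rx≡R) (∣n-pred[n]∣≡1 1≤R))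
  boundary⊆MEG-set _ 1≤C meg (inj₂ (inj₂ (inj₁ cx≡0))) =
    Columns.extreme-row⊆MEG-set meg (subst (Extreme maxCol) (sym cx≡0) 0-extreme) 1≤C (cong (∣_- 1 ∣) cx≡0)
  boundary⊆MEG-set _ 1≤C meg (inj₂ (inj₂ (inj₂ cx≡C))) =
    Columns.extreme-row⊆MEG-set meg (subst (Extreme maxCol) (sym cx≡C) max-extreme) pred[n]≤n
      (trans (cong (∣_- pred maxCol ∣) cx≡C) (∣n-pred[n]∣≡1 1≤C))

  boundary-MEG-set : ∀ {S} → (∀ {x} → OnBoundary x → x ∈ S) → IsMEGSet G S
  boundary-MEG-set ⊆S u v a with m+n≡1⇒ ∣ row u - row v ∣ (Adj⇒distance≡1 a)
  ... | inj₁ ∣ru-rv∣≡0 =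
    vertex (row u) 0 , vertex (row u) maxCol ,
    ⊆S (inj₂ (inj₂ (inj₁ (col-vertex z≤n)))) , ⊆S (inj₂ (inj₂ (inj₂ (col-vertex ≤-refl)))) ,
    row-edge-monitored a (∣m-n∣≡0⇒m≡n ∣ru-rv∣≡0)
  ... | inj₂ ∣cu-cv∣≡0 =
    vertex 0 (col u) , vertex maxRow (col u) ,
    ⊆S (inj₁ (row-vertex z≤n)) , ⊆S (inj₂ (inj₁ (row-vertex ≤-refl))) ,
    ColumnGeodesics.row-edge-monitored a (∣m-n∣≡0⇒m≡n ∣cu-cv∣≡0)

clamp : ∀ n → ℕ → Fin (suc n)
clamp _       zero    = zero
clamp zero    (suc _) = zero
clamp (suc n) (suc p) = suc (clamp n p)

toℕ-clamp : ∀ {n p} → p ≤ n → toℕ (clamp n p) ≡ p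
toℕ-clamp {_}     {zero}  _         = refl
toℕ-clamp {suc n} {suc p} (s≤s p≤n) = cong suc (toℕ-clamp p≤n)

gridChart : ∀ a b → GridChart (Grid (suc a) (suc b))
gridChart a b = record
  { row              = toℕ ∘ proj₁
  ; col              = toℕ ∘ proj₂
  ; maxRow           = a
  ; maxCol           = b
  ; row≤maxRow       = toℕ≤pred[n] ∘ proj₁
  ; col≤maxCol       = toℕ≤pred[n] ∘ proj₂
  ; vertex           = λ p q → clamp a p , clamp b q
  ; row-vertex       = toℕ-clamp
  ; col-vertex       = toℕ-clamp
  ; coords-injective = λ r≡ c≡ → cong₂ _,_ (toℕ-injective r≡) (toℕ-injective c≡)
  ; Adj⇒distance≡1   = id
  ; distance≡1⇒Adj   = id
  }

inner : ∀ n → List (Fin (suc (suc n)))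
inner n = map (suc ∘ inject₁) (allFin n)

inner-unique : ∀ n → Unique (inner n)
inner-unique n = Unique.map⁺ (inject₁-injective ∘ Fin.suc-injective) (Unique.allFin⁺ n)

inner-sound : ∀ {n} {i : Fin (suc (suc n))} → i ∈ inner n → i ≢ zero × i ≢ fromℕ (suc n)
inner-sound i∈ with ∈-map⁻ (suc ∘ inject₁) i∈
... | k , _ , refl = (λ ()) , fromℕ≢inject₁ ∘ Fin.suc-injective ∘ sym

inner-complete : ∀ {n} (i : Fin (suc (suc n))) → i ≢ zero → i ≢ fromℕ (suc n) → i ∈ inner n
inner-complete zero    i≢0 _      = contradiction refl i≢0
inner-complete {n} (suc i) _ i≢last =
  subst (_∈ inner n) (cong suc (inject₁-lower₁ i n≢i)) (∈-map⁺ (suc ∘ inject₁) (∈-allFin (lower₁ i n≢i)))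
  where
  n≢i : n ≢ toℕ i
  n≢i n≡i = i≢last (cong suc (toℕ-injective (trans (sym n≡i) (sym (toℕ-fromℕ n)))))

toℕ≡0⇒≡zero : ∀ {n} {i : Fin (suc n)} → toℕ i ≡ 0 → i ≡ zero
toℕ≡0⇒≡zero {i = zero} _ = refl

toℕ≡n⇒≡fromℕ : ∀ {n} {i : Fin (suc n)} → toℕ i ≡ n → i ≡ fromℕ n
toℕ≡n⇒≡fromℕ {n} i≡n = toℕ-injective (trans i≡n (sym (toℕ-fromℕ n)))

boundary-size : ∀ m n → 2 * (m + suc (suc n)) ≡ suc (suc n) + (suc (suc n) + (m + m))
boundary-size = solve-∀

module GridBoundary (M N : ℕ) where
  open Boundary (gridChart (suc M) (suc N)) public using (OnBoundary; boundary⊆MEG-set; boundary-MEG-set)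

  Vertex : Set
  Vertex = Fin (suc (suc M)) × Fin (suc (suc N))

  lastRow : Fin (suc (suc M))
  lastRow = fromℕ (suc M)

  lastCol : Fin (suc (suc N))
  lastCol = fromℕ (suc N)

  rowList : Fin (suc (suc M)) → List Vertex
  rowList i = map (i ,_) (allFin (suc (suc N)))

  colList : Fin (suc (suc N)) → List Vertex
  colList j = map (_, j) (inner M)

  sideColumns : List Vertex
  sideColumns = colList zero ++ colList lastCol

  boundary : List Vertex
  boundary = rowList zero ++ rowList lastRow ++ sideColumns

  ∈-rowList⁻ : ∀ {x i} → x ∈ rowList i → proj₁ x ≡ i
  ∈-rowList⁻ x∈ with ∈-map⁻ _ x∈
  ... | _ , _ , refl = refl

  ∈-colList⁻ : ∀ {x j} → x ∈ colList j → proj₁ x ∈ inner M × proj₂ x ≡ j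
  ∈-colList⁻ x∈ with ∈-map⁻ _ x∈
  ... | _ , i∈ , refl = i∈ , refl

  ∈-sideColumns⁻ : ∀ {x} → x ∈ sideColumns → proj₁ x ∈ inner M
  ∈-sideColumns⁻ x∈ = [ proj₁ ∘ ∈-colList⁻ , proj₁ ∘ ∈-colList⁻ ]′ (∈-++⁻ (colList zero) x∈)

  length-boundary : length boundary ≡ 2 * (suc (suc M) + suc (suc N) ∸ 2)
  length-boundary = begin
    length boundary                                                   ≡⟨ length-++ (rowList zero) ⟩
    length (rowList zero) + length (rowList lastRow ++ sideColumns)   ≡⟨ cong (length (rowList zero) +_) (length-++ (rowList lastRow)) ⟩
    length (rowList zero) + (length (rowList lastRow) + length sideColumns)
      ≡⟨ cong₂ _+_ (length-rowList zero) (cong₂ _+_ (length-rowList lastRow) length-sideColumns) ⟩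
    suc (suc N) + (suc (suc N) + (M + M))                             ≡⟨ boundary-size M N ⟨
    2 * (M + suc (suc N))                                             ∎
    where
    open ≡-Reasoning
    length-rowList : ∀ i → length (rowList i) ≡ suc (suc N)
    length-rowList i = trans (length-map (i ,_) (allFin (suc (suc N)))) (length-tabulate {n = suc (suc N)} id)
    length-colList : ∀ j → length (colList j) ≡ M
    length-colList j =
      trans (length-map (_, j) (inner M)) (trans (length-map (suc ∘ inject₁) (allFin M)) (length-tabulate {n = M} id))
    length-sideColumns : length sideColumns ≡ M + M
    length-sideColumns = trans (length-++ (colList zero)) (cong₂ _+_ (length-colList zero) (length-colList lastCol))

  boundary-unique : Unique boundary
  boundary-unique =
    Unique.++⁺ (rowList-unique zero)
      (Unique.++⁺ (rowList-unique lastRow)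
        (Unique.++⁺ (colList-unique zero) (colList-unique lastCol) columns-disjoint)
        lastRow-disjoint)
      firstRow-disjoint
    where
    rowList-unique : ∀ i → Unique (rowList i)
    rowList-unique i = Unique.map⁺ (cong proj₂) (Unique.allFin⁺ (suc (suc N)))
    colList-unique : ∀ j → Unique (colList j)
    colList-unique j = Unique.map⁺ (cong proj₁) (inner-unique M)
    columns-disjoint : Disjoint (colList zero) (colList lastCol)
    columns-disjoint (x∈₀ , x∈₁) = Fin.0≢1+n (trans (sym (proj₂ (∈-colList⁻ x∈₀))) (proj₂ (∈-colList⁻ x∈₁)))
    lastRow-disjoint : Disjoint (rowList lastRow) sideColumns
    lastRow-disjoint (x∈ , x∈′) = proj₂ (inner-sound (∈-sideColumns⁻ x∈′)) (∈-rowList⁻ x∈)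
    firstRow-disjoint : Disjoint (rowList zero) (rowList lastRow ++ sideColumns)
    firstRow-disjoint (x∈ , x∈′) with ∈-++⁻ (rowList lastRow) x∈′
    ... | inj₁ x∈last = Fin.0≢1+n (trans (sym (∈-rowList⁻ x∈)) (∈-rowList⁻ x∈last))
    ... | inj₂ x∈cols = proj₁ (inner-sound (∈-sideColumns⁻ x∈cols)) (∈-rowList⁻ x∈)

  boundary-sound : ∀ {x} → x ∈ boundary → OnBoundary x
  boundary-sound x∈ with ∈-++⁻ (rowList zero) x∈
  ... | inj₁ x∈first = inj₁ (cong toℕ (∈-rowList⁻ x∈first))
  ... | inj₂ x∈′ with ∈-++⁻ (rowList lastRow) x∈′
  ...   | inj₁ x∈last = inj₂ (inj₁ (trans (cong toℕ (∈-rowList⁻ x∈last)) (toℕ-fromℕ (suc M))))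
  ...   | inj₂ x∈″ with ∈-++⁻ (colList zero) x∈″
  ...     | inj₁ x∈c₀ = inj₂ (inj₂ (inj₁ (cong toℕ (proj₂ (∈-colList⁻ x∈c₀)))))
  ...     | inj₂ x∈cₙ = inj₂ (inj₂ (inj₂ (trans (cong toℕ (proj₂ (∈-colList⁻ x∈cₙ))) (toℕ-fromℕ (suc N)))))

  firstRow⊆boundary : ∀ j → (zero , j) ∈ boundary
  firstRow⊆boundary j = ∈-++⁺ˡ (∈-map⁺ (zero ,_) (∈-allFin j))

  lastRow⊆boundary : ∀ j → (lastRow , j) ∈ boundary
  lastRow⊆boundary j = ∈-++⁺ʳ (rowList zero) (∈-++⁺ˡ (∈-map⁺ (lastRow ,_) (∈-allFin j)))

  sideColumns⊆boundary : ∀ i {j} → j ≡ zero ⊎ j ≡ lastCol → (i , j) ∈ boundary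
  sideColumns⊆boundary i {j} side with i Fin.≟ zero | i Fin.≟ lastRow
  ... | yes refl | _        = firstRow⊆boundary j
  ... | no _     | yes refl = lastRow⊆boundary j
  ... | no i≢0   | no i≢last = ∈-++⁺ʳ (rowList zero) (∈-++⁺ʳ (rowList lastRow) (in-column side))
    where
    i∈ : (i , j) ∈ colList j
    i∈ = ∈-map⁺ (_, j) (inner-complete i i≢0 i≢last)
    in-column : j ≡ zero ⊎ j ≡ lastCol → (i , j) ∈ sideColumns
    in-column (inj₁ refl) = ∈-++⁺ˡ i∈
    in-column (inj₂ refl) = ∈-++⁺ʳ (colList zero) i∈

  boundary-complete : ∀ {x} → OnBoundary x → x ∈ boundary
  boundary-complete {i , j} (inj₁ r≡0) rewrite toℕ≡0⇒≡zero r≡0 = firstRow⊆boundary j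
  boundary-complete {i , j} (inj₂ (inj₁ r≡M)) rewrite toℕ≡n⇒≡fromℕ r≡M = lastRow⊆boundary j
  boundary-complete {i , j} (inj₂ (inj₂ (inj₁ c≡0))) = sideColumns⊆boundary i (inj₁ (toℕ≡0⇒≡zero c≡0))
  boundary-complete {i , j} (inj₂ (inj₂ (inj₂ c≡N))) = sideColumns⊆boundary i (inj₂ (toℕ≡n⇒≡fromℕ c≡N))

theorem7 : (m n : ℕ) → 2 ≤ m → 2 ≤ n → IsMEG (Grid m n) (2 * (m + n ∸ 2))
theorem7 (suc (suc M)) (suc (suc N)) (s≤s (s≤s z≤n)) (s≤s (s≤s z≤n)) =
  (boundary , boundary-unique , boundary-MEG-set boundary-complete , length-boundary) ,
  λ S _ meg → begin
    2 * (M + suc (suc N)) ≡⟨ length-boundary ⟨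
    length boundary       ≤⟨ Unique-⊆⇒length≤ boundary-unique (boundary⊆MEG-set (s≤s z≤n) (s≤s z≤n) meg ∘ boundary-sound) ⟩
    length S              ∎
  where
  open GridBoundary M N
  open ≤-Reasoning
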